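{- For all integers $a,b,c,d,e,f,g,h$: if $a:b::_m c:d$ and $e:f::_m g:h$, then $a+e:b+f::_m c+g:d+h$, where $::_m$ is the monolinear analogical proportion relation in $(\mathbb Z,+,\mathbb Z)$.
   Context: $(\mathbb Z,+,\mathbb Z)$ is the algebra with universe $\mathbb Z$, binary operation $+$, and a constant symbol for every integer. A justification is a pair of terms $s\to t$ with every variable of $t$ occurring in $s$; $\uparrow(a\to b)$ is the set of justifications with $a=s(\mathbf o)$, $b=t(\mathbf o)$ (evaluated in the algebra) for some assignment $\mathbf o$ of integers to the variables. $\uparrow^m(a\to b)$ keeps those whose terms contain only a single fixed variable $x$, occurring at most once in each side. $\uparrow^m(a\to b:\!\cdot\,c\to d):=\uparrow^m(a\to b)\cap\uparrow^m(c\to d)$; a monolinear justification is trivial if it lies in all such sets. $a\to b:\!\cdot_m\,c\to d$ holds iff either (a) $\uparrow^m(a\to b)\cup\uparrow^m(c\to d)$ consists only of trivial justifications, or (b) with $J_e$ denoting $\uparrow^m(a\to b:\!\cdot\,c\to e)$ minus trivial justifications, $J_d\neq\emptyset$ and $J_d\subseteq J_{d'}$ implies $J_{d'}\subseteq J_d$ for all integers $d'$. Then $a:b::_m c:d$ iff $a\to b:\!\cdot_m\,c\to d$, $b\to a:\!\cdot_m\,d\to c$, $c\to d:\!\cdot_m\,a\to b$ and $d\to c:\!\cdot_m\,b\to a$ all hold. -}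

module Defs where

open import Data.Nat using (ℕ; _<_; _≤_)
import Data.Nat as ℕ
open import Data.Integer using (ℤ; _+_)
open import Data.Product using (_×_; ∃; Σ)
open import Data.Sum using (_⊎_)
open import Relation.Nullary using (¬_)
open import Relation.Binary.PropositionalEquality using (_≡_)

-- Terms of (ℤ,+,ℤ) in the single fixed variable x:
-- the variable, a constant symbol for every integer, and binary +.
data Term : Set where
  var : Term
  con : ℤ → Term
  _⊕_ : Term → Term → Term

occ : Term → ℕ
occ var       = 1
occ (con _)   = 0
occ (s ⊕ t)   = occ s ℕ.+ occ t

eval : Term → ℤ → ℤ
eval var       o = o
eval (con k)   o = k
eval (s ⊕ t)   o = eval s o + eval t o

record Just : Set where
  constructor _⟶_
  field
    lhs : Term
    rhs : Term
open Just public

Monolinear : Just → Set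
Monolinear (s ⟶ t) = (0 < occ t → 0 < occ s) × occ s ≤ 1 × occ t ≤ 1

Up : ℤ → ℤ → Just → Set
Up a b j = Monolinear j × ∃ λ o → eval (lhs j) o ≡ a × eval (rhs j) o ≡ b

Up2 : ℤ → ℤ → ℤ → ℤ → Just → Set
Up2 a b c d j = Up a b j × Up c d j

Trivial : Just → Set
Trivial j = Monolinear j × (∀ a b c d → Up2 a b c d j)

J : ℤ → ℤ → ℤ → ℤ → Just → Set
J a b c e j = Up2 a b c e j × ¬ Trivial j

ArrowProp : ℤ → ℤ → ℤ → ℤ → Set
ArrowProp a b c d =
    (∀ j → (Up a b j ⊎ Up c d j) → Trivial j)
  ⊎ ((∃ λ j → J a b c d j)
     × (∀ d' → (∀ j → J a b c d j → J a b c d' j)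
             → (∀ j → J a b c d' j → J a b c d j)))

Prop : ℤ → ℤ → ℤ → ℤ → Set
Prop a b c d = ArrowProp a b c d × ArrowProp b a d c
             × ArrowProp c d a b × ArrowProp d c b a

-- Every term in one variable x evaluates to k + n·x with n the number of
-- occurrences of x, so a monolinear justification is either constant on the
-- right (forcing b = d) or a translation x ⟶ x + k (forcing a − b = c − d).
-- Hence no justification is trivial and a : b ::_m c : d is exactly the
-- arithmetic proportion a + d = b + c, which is closed under addition.
module Submission where

open import Defs
open import Data.Integer using (ℤ; _+_; _-_; _*_; +_; 0ℤ; 1ℤ)
open import Data.Integer.Properties using (+-comm; +-identityˡ; *-identityˡ; *-zeroˡ; +-identityʳ)
open import Data.Integer.Tactic.RingSolver using (solve-∀)
open import Data.Nat using (_<_; z≤n; s≤s)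
open import Data.Nat.Properties using (n≤1⇒n≡0∨n≡1; n≮0)
open import Data.Product using (_,_; proj₁; proj₂)
open import Data.Sum using (_⊎_; inj₁; inj₂)
open import Data.Empty using (⊥-elim)
open import Relation.Nullary using (¬_)
open import Relation.Binary.PropositionalEquality
  using (_≡_; refl; sym; trans; cong; cong₂; subst; module ≡-Reasoning)

record ArithProp (a b c d : ℤ) : Set where
  constructor arith
  field sum-eq : a + d ≡ b + c

ArithProp-refl : ∀ a b → ArithProp a b a b
ArithProp-refl a b = arith (+-comm a b)

ArithProp-sym : ∀ {a b c d} → ArithProp a b c d → ArithProp b a d c
ArithProp-sym (arith p) = arith (sym p)

ArithProp-swap : ∀ {a b c d} → ArithProp a b c d → ArithProp c d a b
ArithProp-swap {a} {b} {c} {d} (arith p) = arith (trans (+-comm c b) (trans (sym p) (+-comm a d)))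

ArithProp-+ : ∀ {a b c d e f g h} → ArithProp a b c d → ArithProp e f g h
            → ArithProp (a + e) (b + f) (c + g) (d + h)
ArithProp-+ {a} {b} {c} {d} {e} {f} {g} {h} (arith p) (arith q) = arith (begin
  (a + e) + (d + h) ≡⟨ interchange a e d h ⟩
  (a + d) + (e + h) ≡⟨ cong₂ _+_ p q ⟩
  (b + c) + (f + g) ≡⟨ interchange b c f g ⟩
  (b + f) + (c + g) ∎)
  where
  open ≡-Reasoning
  interchange : ∀ w x y z → (w + x) + (y + z) ≡ (w + y) + (x + z)
  interchange = solve-∀

eval-linear : ∀ s o → eval s o ≡ eval s 0ℤ + + occ s * o
eval-linear var     o = sym (trans (+-identityˡ (1ℤ * o)) (*-identityˡ o))
eval-linear (con k) o = sym (trans (cong (λ z → k + z) (*-zeroˡ o)) (+-identityʳ k))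
eval-linear (s ⊕ t) o rewrite eval-linear s o | eval-linear t o =
  regroup (eval s 0ℤ) (eval t 0ℤ) (+ occ s) (+ occ t) o
  where
  regroup : ∀ S T m n x → (S + m * x) + (T + n * x) ≡ (S + T) + (m + n) * x
  regroup = solve-∀

eval-constant : ∀ s → occ s ≡ 0 → ∀ o o′ → eval s o ≡ eval s o′
eval-constant s occ≡0 o o′ rewrite eval-linear s o | eval-linear s o′ | occ≡0 = refl

eval-shift : ∀ s → occ s ≡ 1 → ∀ o → eval s o ≡ eval s 0ℤ + o
eval-shift s occ≡1 o rewrite eval-linear s o | occ≡1 =
  cong (λ z → eval s 0ℤ + z) (*-identityˡ o)

Up2⇒≡⊎ArithProp : ∀ {a b c d} j → Up2 a b c d j → b ≡ d ⊎ ArithProp a b c d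
Up2⇒≡⊎ArithProp {a} {b} {c} {d} (s ⟶ t)
  (((rhsVar⇒lhsVar , occs≤1 , occt≤1) , o , sa , tb) , (_ , o′ , sc , td))
  with n≤1⇒n≡0∨n≡1 occt≤1
... | inj₁ occt≡0 = inj₁ (trans (sym tb) (trans (eval-constant t occt≡0 o o′) td))
... | inj₂ occt≡1 with n≤1⇒n≡0∨n≡1 occs≤1
...   | inj₁ occs≡0 =
  ⊥-elim (n≮0 (subst (0 <_) occs≡0 (rhsVar⇒lhsVar (subst (0 <_) (sym occt≡1) (s≤s z≤n)))))
...   | inj₂ occs≡1 = inj₂ (arith (begin
  a + d              ≡⟨ cong₂ _+_ (shifted s occs≡1 o sa) (shifted t occt≡1 o′ td) ⟩
  (S + o) + (T + o′) ≡⟨ exchange S T o o′ ⟩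
  (T + o) + (S + o′) ≡⟨ sym (cong₂ _+_ (shifted t occt≡1 o tb) (shifted s occs≡1 o′ sc)) ⟩
  b + c              ∎))
  where
  open ≡-Reasoning
  S = eval s 0ℤ
  T = eval t 0ℤ
  shifted : ∀ u → occ u ≡ 1 → ∀ o {x} → eval u o ≡ x → x ≡ eval u 0ℤ + o
  shifted u occ≡1 o refl = eval-shift u occ≡1 o
  exchange : ∀ S T x y → (S + x) + (T + y) ≡ (T + x) + (S + y)
  exchange = solve-∀

¬Trivial : ∀ j → ¬ Trivial j
¬Trivial j (_ , inAll) with Up2⇒≡⊎ArithProp j (inAll 0ℤ 0ℤ 0ℤ 1ℤ)
... | inj₁ ()
... | inj₂ ()

Up-constant : ∀ a b → Up a b (con a ⟶ con b)
Up-constant a b = ((λ ()) , z≤n , z≤n) , 0ℤ , refl , refl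

ArrowProp⇒≡⊎ArithProp : ∀ {a b c d} → ArrowProp a b c d → b ≡ d ⊎ ArithProp a b c d
ArrowProp⇒≡⊎ArithProp {a} {b} (inj₁ allTrivial) =
  ⊥-elim (¬Trivial (con a ⟶ con b) (allTrivial (con a ⟶ con b) (inj₁ (Up-constant a b))))
ArrowProp⇒≡⊎ArithProp (inj₂ ((j , up2 , _) , _)) = Up2⇒≡⊎ArithProp j up2

Prop⇒ArithProp : ∀ {a b c d} → Prop a b c d → ArithProp a b c d
Prop⇒ArithProp {a} {b} (abcd , badc , _)
  with ArrowProp⇒≡⊎ArithProp abcd | ArrowProp⇒≡⊎ArithProp badc
... | inj₂ p      | _          = p
... | inj₁ _      | inj₂ p     = ArithProp-sym p
... | inj₁ refl   | inj₁ refl  = ArithProp-refl a b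

translation : ℤ → Just
translation k = var ⟶ (var ⊕ con k)

Up-translation : ∀ c k → Up c (c + k) (translation k)
Up-translation c k = ((λ _ → s≤s z≤n) , s≤s z≤n , s≤s z≤n) , c , refl , refl

Up-translation⁻¹ : ∀ {c d} k → Up c d (translation k) → d ≡ c + k
Up-translation⁻¹ k (_ , _ , refl , refl) = refl

ArithProp⇒≡+diff : ∀ {a b c d} → ArithProp a b c d → d ≡ c + (b - a)
ArithProp⇒≡+diff {a} {b} {c} {d} (arith a+d≡b+c) = begin
  d             ≡⟨ cancel a d ⟩
  (a + d) - a   ≡⟨ cong (λ z → z - a) a+d≡b+c ⟩
  (b + c) - a   ≡⟨ reassociate a b c ⟩
  c + (b - a)   ∎
  where
  open ≡-Reasoning
  cancel : ∀ x y → y ≡ (x + y) - x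
  cancel = solve-∀
  reassociate : ∀ x y z → (y + z) - x ≡ z + (y - x)
  reassociate = solve-∀

-- The translation by b − a witnesses the proportion and pins down d, so J_d is
-- the only candidate J_d′ containing it.
ArithProp⇒ArrowProp : ∀ {a b c d} → ArithProp a b c d → ArrowProp a b c d
ArithProp⇒ArrowProp {a} {b} {c} {d} p = inj₂ ((translation k , J-translation) , maximal)
  where
  k = b - a
  J-translation : J a b c d (translation k)
  J-translation =
    ( subst (λ x → Up a x (translation k)) (sym (ArithProp⇒≡+diff (ArithProp-refl a b)))
            (Up-translation a k)
    , subst (λ x → Up c x (translation k)) (sym (ArithProp⇒≡+diff p)) (Up-translation c k) )
    , ¬Trivial (translation k)
  maximal : ∀ d′ → (∀ j → J a b c d j → J a b c d′ j) → ∀ j → J a b c d′ j → J a b c d j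
  maximal d′ Jd⊆Jd′ j = subst (λ x → J a b c x j) d′≡d
    where
    d′≡d : d′ ≡ d
    d′≡d = trans (Up-translation⁻¹ k (proj₂ (proj₁ (Jd⊆Jd′ (translation k) J-translation))))
                 (sym (ArithProp⇒≡+diff p))

ArithProp⇒Prop : ∀ {a b c d} → ArithProp a b c d → Prop a b c d
ArithProp⇒Prop p =
    ArithProp⇒ArrowProp p
  , ArithProp⇒ArrowProp (ArithProp-sym p)
  , ArithProp⇒ArrowProp (ArithProp-swap p)
  , ArithProp⇒ArrowProp (ArithProp-sym (ArithProp-swap p))

mainTheorem6 : ∀ (a b c d e f g h : ℤ) → Prop a b c d → Prop e f g h
             → Prop (a + e) (b + f) (c + g) (d + h)
mainTheorem6 a b c d e f g h P Q =
  ArithProp⇒Prop (ArithProp-+ (Prop⇒ArithProp P) (Prop⇒ArithProp Q))
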